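{- For every $n$, there is an injection from $\bar{Q}_1(0,n)$ to $\bar{P}_1(0,n)$.
   Context: Partitions: $\ell(\mu)$ is the number of parts, $s(\mu)$ the smallest part ($s(\emptyset)=+\infty$), $\mu_i=0$ if $\mu$ has fewer than $i$ parts, rank of $\lambda$ is $\lambda_1-\ell(\lambda)$. The rank-set of $\lambda=(\lambda_1\ge\cdots\ge\lambda_\ell>0)$ is $[-\lambda_1,1-\lambda_2,\ldots,\ell-1-\lambda_\ell,\ell,\ell+1,\ldots]$. The Durfee symbol of $\lambda$ is $(\alpha,\beta)_j$, where $j$ is the side of the Durfee square (largest $j$ with $\lambda_j\ge j$, or $0$), $\alpha_i=\lambda'_{j+i}$ are the column lengths to the right of the Durfee square ($\lambda'$ the conjugate) and $\beta=(\lambda_{j+1},\lambda_{j+2},\ldots)$ are the rows below it. $Q(0,n)$ is the set of partitions of $n$ with $0$ in the rank-set; $P(0,n)$ the set of partitions of $n$ with rank $\ge0$. $\bar{Q}_1(0,n)$ is the set of $\lambda\in Q(0,n)$ whose Durfee symbol satisfies $j\ge1$, $\ell(\beta)-\ell(\alpha)\ge1$, $\alpha_1=\alpha_2=j>\alpha_3$ and $s(\beta)\ge3$. $\bar{P}_1(0,n)$ is the set of $\mu\in P(0,n)$ whose Durfee symbol $(\gamma,\delta)_{j'}$ satisfies $j'\ge1$, $\ell(\gamma)=\ell(\delta)$, $\gamma_1\le j'-3$, $\delta_1=j'$ and $s(\delta)\ge2$. -}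

module Defs where

open import Data.Nat as ℕ using (ℕ; zero; suc; _≤_; _<_; _≥_; _∸_; _≤?_)
open import Data.Integer as ℤ using (ℤ; +_)
open import Data.List using (List; []; _∷_; length; map; upTo; drop; filter)
open import Data.Nat.ListAction using (sum)
open import Data.List.Relation.Unary.All using (All)
open import Data.List.Relation.Unary.Linked using (Linked)
open import Data.Product using (Σ; _×_; ∃)
open import Data.Sum using (_⊎_)
open import Relation.Binary.PropositionalEquality using (_≡_)

IsPartitionOf : ℕ → List ℕ → Set
IsPartitionOf n p = Linked _≥_ p × All (1 ≤_) p × sum p ≡ n

-- 0-based lookup with default 0:  nth p i = p_{i+1}  (0 if p has ≤ i parts)
nth : List ℕ → ℕ → ℕ
nth []       _       = 0
nth (x ∷ xs) zero    = x
nth (x ∷ xs) (suc i) = nth xs i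

len : List ℕ → ℕ
len = length

conjAt : List ℕ → ℕ → ℕ
conjAt p k = length (filter (k ≤?_) p)

rank : List ℕ → ℤ
rank p = + nth p 0 ℤ.- + len p

InRankSet : ℤ → List ℕ → Set
InRankSet m p =
  (∃ λ k → k < len p × m ≡ + k ℤ.- + nth p k) ⊎ (+ len p ℤ.≤ m)

-- j is the side of the Durfee square: the largest j with p_j ≥ j (or 0)
IsDurfeeSide : List ℕ → ℕ → Set
IsDurfeeSide p j =
  (j ≤ nth p (j ∸ 1)) × (∀ k → 1 ≤ k → k ≤ nth p (k ∸ 1) → k ≤ j)

-- α: column lengths to the right of the Durfee square, α_i = p'_{j+i}, i = 1..p₁-j
durfeeα : List ℕ → ℕ → List ℕ
durfeeα p j = map (λ i → conjAt p (j ℕ.+ suc i)) (upTo (nth p 0 ∸ j))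

durfeeβ : List ℕ → ℕ → List ℕ
durfeeβ p j = drop j p

-- s(μ) ≥ c  (with s(∅) = +∞, so vacuous for the empty partition)
SmallestAtLeast : ℕ → List ℕ → Set
SmallestAtLeast c μ = All (c ≤_) μ

InQ0 : ℕ → List ℕ → Set
InQ0 n p = IsPartitionOf n p × InRankSet (+ 0) p

InP0 : ℕ → List ℕ → Set
InP0 n μ = IsPartitionOf n μ × (+ 0 ℤ.≤ rank μ)

InQbar1 : ℕ → List ℕ → Set
InQbar1 n p = InQ0 n p × Σ ℕ λ j → IsDurfeeSide p j ×
  (let α = durfeeα p j ; β = durfeeβ p j in
     1 ≤ j
   × (+ 1 ℤ.≤ + len β ℤ.- + len α)
   × nth α 0 ≡ j × nth α 1 ≡ j × nth α 2 < j
   × SmallestAtLeast 3 β)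

InPbar1 : ℕ → List ℕ → Set
InPbar1 n μ = InP0 n μ × Σ ℕ λ j' → IsDurfeeSide μ j' ×
  (let γ = durfeeα μ j' ; δ = durfeeβ μ j' in
     1 ≤ j'
   × len γ ≡ len δ
   × (+ nth γ 0 ℤ.≤ + j' ℤ.- + 3)
   × nth δ 0 ≡ j'
   × SmallestAtLeast 2 δ)

-- Let λ ∈ Q̄₁(0,n) have Durfee side j and ℓ parts. 0 lies in its rank-set only through a part
-- λ_{k+1} = k, and such a k is the Durfee side. So λ_{j+1} = j, all parts are ≥ 3, λ₁ < ℓ,
-- and the conjugate, padded with zeros, is
--   λ' = (ℓ, ℓ, ℓ, λ'₄, …, λ'ⱼ, j, j, λ'_{j+3}, …, λ'_ℓ)   with λ'ⱼ > j > λ'_{j+3}.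
-- Delete the columns λ'₁, λ'₂, λ'_{j+1}, λ'_{j+2} (weight 2ℓ + 2j), and put back four parts j+1
-- and 2 on each of the ℓ-j-2 remaining columns (weight 4(j+1) + 2(ℓ-j-2)):
--   φ(λ) = (λ'₃, …, λ'ⱼ, j+1, j+1, j+1, j+1, λ'_{j+3}+2, …, λ'_ℓ+2).
-- This is a partition of n with ℓ parts, largest part λ'₃ = ℓ and Durfee side j+1, lying in
-- P̄₁(0,n). Its Durfee side gives back j, and then its parts give back every λ'_k, hence λ.

module Submission where

open import Defs
open import Data.Nat
  using (ℕ; zero; suc; _+_; _*_; _∸_; _≤_; _<_; _≥_; _≰_; _≤?_; z≤n; s≤s)
open import Data.Nat.Properties
open import Data.Nat.ListAction using (sum)
open import Data.Nat.ListAction.Properties using (sum-++)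
open import Data.Nat.Tactic.RingSolver using (solve-∀)
open import Algebra.Properties.CommutativeSemigroup +-commutativeSemigroup using (interchange)
open import Data.Integer as ℤ using (+≤+; _⊖_)
import Data.Integer.Properties as ℤP
open import Data.List
  using (List; []; _∷_; _++_; length; filter; drop; upTo; applyUpTo; replicate)
open import Data.List.Properties
  using (length-++; length-map; length-upTo; length-applyUpTo; length-drop; length-filter;
         filter-++; filter-accept; filter-reject; map-upTo)
open import Data.List.Relation.Unary.All as All using (All; []; _∷_)
import Data.List.Relation.Unary.All.Properties as All
open import Data.List.Relation.Unary.Linked using (Linked; []; [-]; _∷_)
import Data.List.Relation.Unary.Linked as Linked
import Data.List.Relation.Unary.Linked.Properties as Linked
open import Data.Product using (Σ; ∃-syntax; _,_; proj₁; proj₂)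
open import Data.Sum using (inj₁; inj₂)
open import Function using (_∘_)
open import Relation.Nullary using (yes; no; contradiction)
open import Relation.Binary.Definitions using (tri<; tri≈; tri>)
open import Relation.Binary.PropositionalEquality

nth-++ˡ : ∀ xs ys {i} → i < length xs → nth (xs ++ ys) i ≡ nth xs i
nth-++ˡ (x ∷ xs) ys {zero}  _         = refl
nth-++ˡ (x ∷ xs) ys {suc i} (s≤s i<n) = nth-++ˡ xs ys i<n

nth-applyUpTo : ∀ f {n i} → i < n → nth (applyUpTo f n) i ≡ f i
nth-applyUpTo f {suc n} {zero}  _         = refl
nth-applyUpTo f {suc n} {suc i} (s≤s i<n) = nth-applyUpTo (f ∘ suc) i<n

nth-applyUpTo-≥ : ∀ f {n i} → n ≤ i → nth (applyUpTo f n) i ≡ 0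
nth-applyUpTo-≥ f {zero}          _         = refl
nth-applyUpTo-≥ f {suc n} {suc i} (s≤s n≤i) = nth-applyUpTo-≥ (f ∘ suc) n≤i

nth-drop : ∀ m xs i → nth (drop m xs) i ≡ nth xs (i + m)
nth-drop zero    xs       i = cong (nth xs) (sym (+-identityʳ i))
nth-drop (suc m) []       i = refl
nth-drop (suc m) (x ∷ xs) i =
  trans (nth-drop m xs i) (cong (nth (x ∷ xs)) (sym (+-suc i m)))

drop-++ʳ : ∀ (xs ys : List ℕ) c → drop (length xs + c) (xs ++ ys) ≡ drop c ys
drop-++ʳ []       ys c = refl
drop-++ʳ (x ∷ xs) ys c = drop-++ʳ xs ys c

nth-≤ : ∀ {b xs} → All (_≤ b) xs → ∀ i → nth xs i ≤ b
nth-≤ []         i       = z≤n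
nth-≤ (px ∷ _)   zero    = px
nth-≤ (_ ∷ pxs)  (suc i) = nth-≤ pxs i

0<nth⇒<length : ∀ xs i → 0 < nth xs i → i < length xs
0<nth⇒<length (x ∷ xs) zero    _ = s≤s z≤n
0<nth⇒<length (x ∷ xs) (suc i) p = s≤s (0<nth⇒<length xs i p)

All-drop⇒nth : ∀ {P : ℕ → Set} xs j → All P (drop j xs) → j < length xs → P (nth xs j)
All-drop⇒nth (x ∷ xs) zero    (px ∷ _) _         = px
All-drop⇒nth (x ∷ xs) (suc j) pxs      (s≤s j<n) = All-drop⇒nth xs j pxs j<n

All-split : ∀ {P : ℕ → Set} xs j →
  (∀ i → i < j → P (nth xs i)) → All P (drop j xs) → All P xs
All-split []       j       _   _   = []
All-split (x ∷ xs) zero    _   pxs = pxs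
All-split (x ∷ xs) (suc j) pre pxs =
  pre 0 (s≤s z≤n) ∷ All-split xs j (λ i i<j → pre (suc i) (s≤s i<j)) pxs

nth-ext : ∀ {xs ys} → All (1 ≤_) xs → All (1 ≤_) ys →
  (∀ i → nth xs i ≡ nth ys i) → xs ≡ ys
nth-ext []         []         _  = refl
nth-ext []         (py ∷ _)   eq = contradiction (sym (eq 0)) (>⇒≢ py)
nth-ext (px ∷ _)   []         eq = contradiction (eq 0) (>⇒≢ px)
nth-ext (_ ∷ pxs)  (_ ∷ pys)  eq = cong₂ _∷_ (eq 0) (nth-ext pxs pys (eq ∘ suc))

≤-head : ∀ {xs} → Linked _≥_ xs → All (_≤ nth xs 0) xs
≤-head {[]}    _  = []
≤-head {_ ∷ _} lx = Linked.Linked⇒All (λ y≤x z≤y → ≤-trans z≤y y≤x) ≤-refl lx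

nth-antimono : ∀ {xs} → Linked _≥_ xs → ∀ {i i'} → i ≤ i' → nth xs i' ≤ nth xs i
nth-antimono {[]}     _                    _          = z≤n
nth-antimono {x ∷ xs} lx {zero}  {i'}      _          = nth-≤ (≤-head lx) i'
nth-antimono {x ∷ xs} lx {suc i} {suc i'} (s≤s i≤i') = nth-antimono (Linked.tail lx) i≤i'

≥-++⁺ : ∀ {b xs ys} → Linked _≥_ xs → Linked _≥_ ys →
  All (b ≤_) xs → All (_≤ b) ys → Linked _≥_ (xs ++ ys)
≥-++⁺                 []         lys _          _          = lys
≥-++⁺ {ys = []}       [-]        _   _          _          = [-]
≥-++⁺ {ys = y ∷ ys}   [-]        lys (b≤x ∷ _)  (y≤b ∷ _)  = ≤-trans y≤b b≤x ∷ lys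
≥-++⁺                 (x≥y ∷ lx) lys (_ ∷ b≤xs) ys≤b       = x≥y ∷ ≥-++⁺ lx lys b≤xs ys≤b

-- Conjugate partitions

conjAt-∷-≤ : ∀ {k x} xs → k ≤ x → conjAt (x ∷ xs) k ≡ suc (conjAt xs k)
conjAt-∷-≤ {k} xs k≤x = cong length (filter-accept (k ≤?_) {xs = xs} k≤x)

conjAt-∷-≰ : ∀ {k x} xs → k ≰ x → conjAt (x ∷ xs) k ≡ conjAt xs k
conjAt-∷-≰ {k} xs k≰x = cong length (filter-reject (k ≤?_) {xs = xs} k≰x)

conjAt-++ : ∀ xs ys k → conjAt (xs ++ ys) k ≡ conjAt xs k + conjAt ys k
conjAt-++ xs ys k =
  trans (cong length (filter-++ (k ≤?_) xs ys)) (length-++ (filter (k ≤?_) xs))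

conjAt≡0 : ∀ {k xs} → All (_< k) xs → conjAt xs k ≡ 0
conjAt≡0 []                        = refl
conjAt≡0 {xs = _ ∷ xs} (x<k ∷ pxs) = trans (conjAt-∷-≰ xs (<⇒≱ x<k)) (conjAt≡0 pxs)

conjAt≡length : ∀ {k xs} → All (k ≤_) xs → conjAt xs k ≡ length xs
conjAt≡length []                        = refl
conjAt≡length {xs = _ ∷ xs} (k≤x ∷ pxs) =
  trans (conjAt-∷-≤ xs k≤x) (cong suc (conjAt≡length pxs))

conjAt-antimono : ∀ xs {k k'} → k ≤ k' → conjAt xs k' ≤ conjAt xs k
conjAt-antimono []                 _    = z≤n
conjAt-antimono (x ∷ xs) {k} {k'} k≤k' with k' ≤? x | k ≤? x
... | yes k'≤x | _
  rewrite conjAt-∷-≤ xs k'≤x | conjAt-∷-≤ xs (≤-trans k≤k' k'≤x) = s≤s (conjAt-antimono xs k≤k')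
... | no k'≰x  | yes k≤x
  rewrite conjAt-∷-≰ xs k'≰x | conjAt-∷-≤ xs k≤x = m≤n⇒m≤1+n (conjAt-antimono xs k≤k')
... | no k'≰x  | no k≰x
  rewrite conjAt-∷-≰ xs k'≰x | conjAt-∷-≰ xs k≰x = conjAt-antimono xs k≤k'

conjAt≤length : ∀ xs k → conjAt xs k ≤ length xs
conjAt≤length xs k = length-filter (k ≤?_) xs

≤nth⇒<conjAt : ∀ {xs} → Linked _≥_ xs → ∀ {k} → 1 ≤ k →
  ∀ i → k ≤ nth xs i → i < conjAt xs k
≤nth⇒<conjAt {[]}     _  1≤k i k≤0  = contradiction k≤0 (<⇒≱ 1≤k)
≤nth⇒<conjAt {x ∷ xs} lx 1≤k i k≤xᵢ
  rewrite conjAt-∷-≤ xs (≤-trans k≤xᵢ (nth-≤ (≤-head lx) i)) with i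
... | zero  = s≤s z≤n
... | suc i = s≤s (≤nth⇒<conjAt (Linked.tail lx) 1≤k i k≤xᵢ)

<conjAt⇒≤nth : ∀ {xs} → Linked _≥_ xs → ∀ {k} i → i < conjAt xs k → k ≤ nth xs i
<conjAt⇒≤nth {x ∷ xs} lx {k} i i<c with k ≤? x
<conjAt⇒≤nth {x ∷ xs} lx {k} zero    _   | yes k≤x = k≤x
<conjAt⇒≤nth {x ∷ xs} lx {k} (suc i) i<c | yes k≤x rewrite conjAt-∷-≤ xs k≤x =
  <conjAt⇒≤nth (Linked.tail lx) i (≤-pred i<c)
... | no k≰x = contradiction (subst (i <_) (conjAt≡0 xs<k) i<c) λ ()
  where
  xs<k : All (_< k) (x ∷ xs)
  xs<k = All.map (λ y≤x → ≤-<-trans y≤x (≰⇒> k≰x)) (≤-head lx)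

conjAt-injective : ∀ {xs ys} → Linked _≥_ xs → Linked _≥_ ys →
  All (1 ≤_) xs → All (1 ≤_) ys →
  (∀ k → 1 ≤ k → conjAt xs k ≡ conjAt ys k) → xs ≡ ys
conjAt-injective lx ly px py eq =
  nth-ext px py (λ i → ≤-antisym (nth-≤nth lx ly eq i) (nth-≤nth ly lx (λ k → sym ∘ eq k) i))
  where
  nth-≤nth : ∀ {xs ys} → Linked _≥_ xs → Linked _≥_ ys →
    (∀ k → 1 ≤ k → conjAt xs k ≡ conjAt ys k) → ∀ i → nth xs i ≤ nth ys i
  nth-≤nth {xs} lx ly eq i with nth xs i in xᵢ≡
  ... | zero  = z≤n
  ... | suc v = <conjAt⇒≤nth ly i (subst (i <_) (eq (suc v) (s≤s z≤n))
                  (≤nth⇒<conjAt lx (s≤s z≤n) i (≤-reflexive (sym xᵢ≡))))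

applyUpTo-cong : ∀ {f g : ℕ → ℕ} n → (∀ i → f i ≡ g i) → applyUpTo f n ≡ applyUpTo g n
applyUpTo-cong zero    _   = refl
applyUpTo-cong (suc n) f≗g = cong₂ _∷_ (f≗g 0) (applyUpTo-cong n (f≗g ∘ suc))

applyUpTo-++ : ∀ (f : ℕ → ℕ) m n →
  applyUpTo f (m + n) ≡ applyUpTo f m ++ applyUpTo (λ i → f (m + i)) n
applyUpTo-++ f zero    n = refl
applyUpTo-++ f (suc m) n = cong (f 0 ∷_) (applyUpTo-++ (f ∘ suc) m n)

sum-applyUpTo-+ : ∀ (f g : ℕ → ℕ) n →
  sum (applyUpTo (λ i → f i + g i) n) ≡ sum (applyUpTo f n) + sum (applyUpTo g n)
sum-applyUpTo-+ f g zero    = refl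
sum-applyUpTo-+ f g (suc n) = trans
  (cong (f 0 + g 0 +_) (sum-applyUpTo-+ (f ∘ suc) (g ∘ suc) n))
  (interchange (f 0) (g 0) _ _)

sum-applyUpTo-const : ∀ n c → sum (applyUpTo (λ _ → c) n) ≡ n * c
sum-applyUpTo-const zero    c = refl
sum-applyUpTo-const (suc n) c = cong (c +_) (sum-applyUpTo-const n c)

conjAt-[suc] : ∀ x k → conjAt (suc x ∷ []) (suc k) ≡ conjAt (x ∷ []) k
conjAt-[suc] x k with k ≤? x
... | yes k≤x = trans (conjAt-∷-≤ [] (s≤s k≤x)) (sym (conjAt-∷-≤ [] k≤x))
... | no k≰x  = trans (conjAt-∷-≰ [] (k≰x ∘ ≤-pred)) (sym (conjAt-∷-≰ [] k≰x))

sum-conjAt-[_] : ∀ {N} x → x ≤ N → sum (applyUpTo (λ i → conjAt (x ∷ []) (suc i)) N) ≡ x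
sum-conjAt-[_] {N}     zero    _         = trans (sum-applyUpTo-const N 0) (*-zeroʳ N)
sum-conjAt-[_] {suc N} (suc x) (s≤s x≤N) = cong₂ _+_
  (conjAt-∷-≤ {x = suc x} [] (s≤s z≤n))
  (trans (cong sum (applyUpTo-cong N (conjAt-[suc] x ∘ suc))) (sum-conjAt-[ x ] x≤N))

sum-conjAt : ∀ {N} xs → All (_≤ N) xs →
  sum (applyUpTo (λ i → conjAt xs (suc i)) N) ≡ sum xs
sum-conjAt {N} []       []          = trans (sum-applyUpTo-const N 0) (*-zeroʳ N)
sum-conjAt {N} (x ∷ xs) (x≤N ∷ pxs) = begin
  sum (applyUpTo (λ i → conjAt (x ∷ xs) (suc i)) N)
    ≡⟨ cong sum (applyUpTo-cong N (conjAt-++ (x ∷ []) xs ∘ suc)) ⟩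
  sum (applyUpTo (λ i → conjAt (x ∷ []) (suc i) + conjAt xs (suc i)) N)
    ≡⟨ sum-applyUpTo-+ _ _ N ⟩
  sum (applyUpTo (λ i → conjAt (x ∷ []) (suc i)) N)
    + sum (applyUpTo (λ i → conjAt xs (suc i)) N)
    ≡⟨ cong₂ _+_ (sum-conjAt-[ x ] x≤N) (sum-conjAt xs pxs) ⟩
  x + sum xs ∎
  where open ≡-Reasoning

-- Durfee squares and rank-sets

1≤m⊖n⇒n<m : ∀ m n → ℤ.+ 1 ℤ.≤ m ⊖ n → n < m
1≤m⊖n⇒n<m m       zero    (+≤+ 1≤m) = 1≤m
1≤m⊖n⇒n<m (suc m) (suc n) 1≤m⊖n     =
  s≤s (1≤m⊖n⇒n<m m n (subst (ℤ.+ 1 ℤ.≤_) (ℤP.[1+m]⊖[1+n]≡m⊖n m n) 1≤m⊖n))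

1≤m-n⇒n<m : ∀ m n → ℤ.+ 1 ℤ.≤ ℤ.+ m ℤ.- ℤ.+ n → n < m
1≤m-n⇒n<m m n = 1≤m⊖n⇒n<m m n ∘ subst (ℤ.+ 1 ℤ.≤_) (ℤP.m-n≡m⊖n m n)

durfeeSide-unique : ∀ {p j j'} → IsDurfeeSide p j → IsDurfeeSide p j' → j ≡ j'
durfeeSide-unique {p} (j≤ , maximal) (j'≤ , maximal') =
  ≤-antisym (below j≤ maximal') (below j'≤ maximal)
  where
  below : ∀ {a b} → a ≤ nth p (a ∸ 1) →
    (∀ k → 1 ≤ k → k ≤ nth p (k ∸ 1) → k ≤ b) → a ≤ b
  below {zero}  _  _       = z≤n
  below {suc a} a≤ maximal = maximal (suc a) (s≤s z≤n) a≤

durfeeSide-fixedPoint : ∀ {p j k} → Linked _≥_ p → IsDurfeeSide p j → nth p k ≡ k → k ≡ j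
durfeeSide-fixedPoint {p} {j} {k} lp (j≤ , maximal) pₖ≡k with <-cmp k j
... | tri≈ _ k≡j _ = k≡j
... | tri< k<j _ _ = contradiction
  (≤-trans j≤ (≤-trans (nth-antimono lp (∸-monoˡ-≤ 1 k<j)) (≤-reflexive pₖ≡k))) (<⇒≱ k<j)
... | tri> _ _ j<k = contradiction
  (maximal k (≤-trans (s≤s z≤n) j<k)
    (≤-trans (≤-reflexive (sym pₖ≡k)) (nth-antimono lp (m∸n≤m k 1))))
  (<⇒≱ j<k)

0∈rankSet⇒fixedPoint : ∀ {p} → 0 < length p → InRankSet (ℤ.+ 0) p → ∃[ k ] nth p k ≡ k
0∈rankSet⇒fixedPoint _   (inj₁ (k , _ , 0≡k-pₖ)) =
  k , sym (ℤP.+-injective (ℤP.i-j≡0⇒i≡j _ _ (sym 0≡k-pₖ)))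
0∈rankSet⇒fixedPoint 0<ℓ (inj₂ (+≤+ ℓ≤0))        = contradiction ℓ≤0 (<⇒≱ 0<ℓ)

length-durfeeα : ∀ p j → length (durfeeα p j) ≡ nth p 0 ∸ j
length-durfeeα p j = trans (length-map _ (upTo (nth p 0 ∸ j))) (length-upTo (nth p 0 ∸ j))

nth-durfeeα : ∀ {p} → Linked _≥_ p → ∀ j i → nth (durfeeα p j) i ≡ conjAt p (j + suc i)
nth-durfeeα {p} lp j i rewrite map-upTo (λ i → conjAt p (j + suc i)) (nth p 0 ∸ j)
  with i <? nth p 0 ∸ j
... | yes i<m = nth-applyUpTo _ i<m
... | no  i≮m = trans (nth-applyUpTo-≥ _ m≤i) (sym (conjAt≡0 (All.map
  (λ x≤p₀ → ≤-<-trans x≤p₀ (≤-<-trans p₀≤j+i (+-monoʳ-< j ≤-refl))) (≤-head lp))))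
  where
  m≤i : nth p 0 ∸ j ≤ i
  m≤i = ≮⇒≥ i≮m
  p₀≤j+i : nth p 0 ≤ j + i
  p₀≤j+i = ≤-trans (m≤n+m∸n (nth p 0) j) (+-monoʳ-≤ j m≤i)

record Q̄₁Shape (n : ℕ) (p : List ℕ) (j : ℕ) : Set where
  field
    sorted  : Linked _≥_ p
    parts≥3 : All (3 ≤_) p
    sum≡n   : sum p ≡ n
    3≤j     : 3 ≤ j
    j<p'ⱼ   : j < conjAt p j
    p'ⱼ₊₁≡j : conjAt p (j + 1) ≡ j
    p'ⱼ₊₂≡j : conjAt p (j + 2) ≡ j
    p'ⱼ₊₃<j : conjAt p (j + 3) < j
    p₁<ℓ    : nth p 0 < length p

Q̄₁⇒shape : ∀ {n p} (q : InQbar1 n p) → Q̄₁Shape n p (proj₁ (proj₂ q))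
Q̄₁⇒shape {p = p}
  (((lp , _ , sum≡n) , 0∈ranks) , j , durfee , 1≤j , ℓβ-ℓα≥1 , α₀≡j , α₁≡j , α₂<j , β≥3) = record
  { sorted  = lp
  ; parts≥3 = All-split p j
      (λ i i<j → ≤-trans 3≤j (≤-trans (≤-reflexive (sym pⱼ≡j)) (nth-antimono lp (<⇒≤ i<j)))) β≥3
  ; sum≡n   = sum≡n
  ; 3≤j     = 3≤j
  ; j<p'ⱼ   = ≤nth⇒<conjAt lp 1≤j j (≤-reflexive (sym pⱼ≡j))
  ; p'ⱼ₊₁≡j = trans (sym (nth-durfeeα lp j 0)) α₀≡j
  ; p'ⱼ₊₂≡j = trans (sym (nth-durfeeα lp j 1)) α₁≡j
  ; p'ⱼ₊₃<j = subst (_< j) (nth-durfeeα lp j 2) α₂<j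
  ; p₁<ℓ    = p₁<ℓ
  }
  where
  p₁<ℓ : nth p 0 < length p
  p₁<ℓ = ≰⇒> λ ℓ≤p₁ → <⇒≱ (1≤m-n⇒n<m _ _ ℓβ-ℓα≥1′) (∸-monoˡ-≤ j ℓ≤p₁)
    where
    ℓβ-ℓα≥1′ : ℤ.+ 1 ℤ.≤ ℤ.+ (length p ∸ j) ℤ.- ℤ.+ (nth p 0 ∸ j)
    ℓβ-ℓα≥1′ = subst₂ (λ a b → ℤ.+ 1 ℤ.≤ ℤ.+ a ℤ.- ℤ.+ b)
      (length-drop j p) (length-durfeeα p j) ℓβ-ℓα≥1

  pⱼ≡j : nth p j ≡ j
  pⱼ≡j with 0∈rankSet⇒fixedPoint {p} (≤-<-trans z≤n p₁<ℓ) 0∈ranks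
  ... | k , pₖ≡k = subst (λ i → nth p i ≡ i) (durfeeSide-fixedPoint lp durfee pₖ≡k) pₖ≡k

  3≤j : 3 ≤ j
  3≤j = subst (3 ≤_) pⱼ≡j
    (All-drop⇒nth p j β≥3 (0<nth⇒<length p j (subst (0 <_) (sym pⱼ≡j) 1≤j)))

-- The injection

innerColumns : List ℕ → ℕ → List ℕ
innerColumns p j = applyUpTo (λ i → conjAt p (3 + i)) (j ∸ 2)

outerColumns : List ℕ → ℕ → List ℕ
outerColumns p j = applyUpTo (λ i → 2 + conjAt p (j + (3 + i))) (length p ∸ (j + 2))

φ : List ℕ → ℕ → List ℕ
φ p j = innerColumns p j ++ replicate 4 (suc j) ++ outerColumns p j

-- For k > length p the last clause reads past the end of φ p j, where nth gives 0 = 0 ∸ 2.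
recoverConj : List ℕ → ℕ → ℕ → ℕ
recoverConj μ j k with k ≤? 3 | k ≤? j | k ≤? j + 2
... | yes _ | _     | _     = length μ
... | no _  | yes _ | _     = nth μ (k ∸ 3)
... | no _  | no _  | yes _ = j
... | no _  | no _  | no _  = nth (drop (2 + j) μ) (k ∸ (j + 3)) ∸ 2

module φ-Properties {n p j} (S : Q̄₁Shape n p j) where
  open Q̄₁Shape S

  ℓ d e : ℕ
  ℓ = length p
  d = j ∸ 2
  e = ℓ ∸ (j + 2)

  2+d≡j : 2 + d ≡ j
  2+d≡j = m+[n∸m]≡n (≤-trans (n≤1+n 2) 3≤j)

  j+2≤p₁ : j + 2 ≤ nth p 0
  j+2≤p₁ = <conjAt⇒≤nth sorted 0 (subst (0 <_) (sym p'ⱼ₊₂≡j) (≤-trans (s≤s z≤n) 3≤j))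

  j+2+e≡ℓ : j + 2 + e ≡ ℓ
  j+2+e≡ℓ = m+[n∸m]≡n (≤-trans j+2≤p₁ (<⇒≤ p₁<ℓ))

  parts≤ℓ : All (_≤ ℓ) p
  parts≤ℓ = All.map (λ x≤p₁ → ≤-trans x≤p₁ (<⇒≤ p₁<ℓ)) (≤-head sorted)

  length-inner : length (innerColumns p j) ≡ d
  length-inner = length-applyUpTo _ d

  inner≥ : All (suc j ≤_) (innerColumns p j)
  inner≥ = All.applyUpTo⁺₁ _ d λ i<d →
    ≤-trans j<p'ⱼ (conjAt-antimono p (≤-trans (+-monoʳ-≤ 2 i<d) (≤-reflexive 2+d≡j)))

  outer≤ : All (_≤ suc j) (outerColumns p j)
  outer≤ = All.applyUpTo⁺₂ _ e λ i →
    s≤s (≤-trans (s≤s (conjAt-antimono p (+-monoʳ-≤ j (m≤m+n 3 i)))) p'ⱼ₊₃<j)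

  outer≥2 : All (2 ≤_) (outerColumns p j)
  outer≥2 = All.applyUpTo⁺₂ _ e λ _ → s≤s (s≤s z≤n)

  corner+outer≤ : All (_≤ suc j) (replicate 4 (suc j) ++ outerColumns p j)
  corner+outer≤ = ≤-refl ∷ ≤-refl ∷ ≤-refl ∷ ≤-refl ∷ outer≤

  φ-sorted : Linked _≥_ (φ p j)
  φ-sorted = ≥-++⁺ inner-sorted corner+outer-sorted inner≥ corner+outer≤
    where
    inner-sorted : Linked _≥_ (innerColumns p j)
    inner-sorted = Linked.applyUpTo⁺₂ _ d λ i → conjAt-antimono p (n≤1+n (3 + i))
    outer-sorted : Linked _≥_ (outerColumns p j)
    outer-sorted = Linked.applyUpTo⁺₂ _ e λ i →
      +-monoʳ-≤ 2 (conjAt-antimono p (≤-trans (n≤1+n _) (≤-reflexive (sym (+-suc j (3 + i))))))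
    corner+outer-sorted : Linked _≥_ (replicate 4 (suc j) ++ outerColumns p j)
    corner+outer-sorted = ≥-++⁺ (≤-refl ∷ ≤-refl ∷ ≤-refl ∷ [-]) outer-sorted
      (≤-refl ∷ ≤-refl ∷ ≤-refl ∷ ≤-refl ∷ []) outer≤

  φ-positive : All (1 ≤_) (φ p j)
  φ-positive = All.++⁺ (All.map (≤-trans (s≤s z≤n)) inner≥)
    (s≤s z≤n ∷ s≤s z≤n ∷ s≤s z≤n ∷ s≤s z≤n ∷ All.map (≤-trans (s≤s z≤n)) outer≥2)

  length-φ : length (φ p j) ≡ ℓ
  length-φ = begin
    length (φ p j)
      ≡⟨ length-++ (innerColumns p j) ⟩
    length (innerColumns p j) + (4 + length (outerColumns p j))
      ≡⟨ cong₂ (λ a b → a + (4 + b)) length-inner (length-applyUpTo _ e) ⟩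
    d + (4 + e)     ≡⟨ rearrange d e ⟩
    2 + d + 2 + e   ≡⟨ cong (λ x → x + 2 + e) 2+d≡j ⟩
    j + 2 + e       ≡⟨ j+2+e≡ℓ ⟩
    ℓ               ∎
    where
    open ≡-Reasoning
    rearrange : ∀ d e → d + (4 + e) ≡ 2 + d + 2 + e
    rearrange = solve-∀

  head-φ : nth (φ p j) 0 ≡ ℓ
  head-φ = begin
    nth (φ p j) 0             ≡⟨ nth-++ˡ (innerColumns p j) _ (subst (0 <_) (sym length-inner) 0<d) ⟩
    nth (innerColumns p j) 0  ≡⟨ nth-applyUpTo _ 0<d ⟩
    conjAt p 3                ≡⟨ conjAt≡length parts≥3 ⟩
    ℓ                         ∎
    where
    open ≡-Reasoning
    0<d : 0 < d
    0<d = ∸-monoˡ-≤ 2 3≤j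

  drop-φ : ∀ c → drop (c + j) (φ p j) ≡ drop c (suc j ∷ suc j ∷ outerColumns p j)
  drop-φ c = begin
    drop (c + j) (φ p j)
      ≡⟨ cong (λ x → drop x (φ p j)) index ⟩
    drop (length (innerColumns p j) + (2 + c)) (φ p j)
      ≡⟨ drop-++ʳ (innerColumns p j) _ (2 + c) ⟩
    drop c (suc j ∷ suc j ∷ outerColumns p j) ∎
    where
    open ≡-Reasoning
    shuffle : ∀ c d → c + (2 + d) ≡ d + (2 + c)
    shuffle = solve-∀
    index : c + j ≡ length (innerColumns p j) + (2 + c)
    index = trans (cong (c +_) (sym 2+d≡j))
                  (trans (shuffle c d) (cong (_+ (2 + c)) (sym length-inner)))

  ΣA ΣT : ℕ
  ΣA = sum (innerColumns p j)
  ΣT = sum (applyUpTo (λ i → conjAt p (j + (3 + i))) e)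

  n≡ : n ≡ ℓ + (ℓ + (ΣA + (j + (j + ΣT))))
  n≡ = begin
    n                                       ≡⟨ sym sum≡n ⟩
    sum p                                   ≡⟨ sym (sum-conjAt p parts≤ℓ) ⟩
    sum (applyUpTo p' ℓ)                    ≡⟨ cong (sum ∘ applyUpTo p') ℓ≡ ⟩
    sum (applyUpTo p' (2 + (d + (2 + e))))
      ≡⟨ cong (λ xs → p' 0 + (p' 1 + sum xs)) (applyUpTo-++ _ d (2 + e)) ⟩
    p' 0 + (p' 1 + sum (innerColumns p j ++ applyUpTo (λ i → conjAt p (3 + (d + i))) (2 + e)))
      ≡⟨ cong (λ x → p' 0 + (p' 1 + x)) (sum-++ (innerColumns p j) _) ⟩
    p' 0 + (p' 1 + (ΣA + (conjAt p (3 + (d + 0)) + (conjAt p (3 + (d + 1))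
      + sum (applyUpTo (λ i → conjAt p (3 + (d + (2 + i)))) e)))))
      ≡⟨ cong₂ _+_ (conjAt≡length (All.map (≤-trans (s≤s z≤n)) parts≥3))
           (cong₂ _+_ (conjAt≡length (All.map (≤-trans (n≤1+n 2)) parts≥3))
             (cong (ΣA +_) (cong₂ _+_ (trans (cong (conjAt p) (shift 0)) p'ⱼ₊₁≡j)
               (cong₂ _+_ (trans (cong (conjAt p) (shift 1)) p'ⱼ₊₂≡j)
                 (cong sum (applyUpTo-cong e (cong (conjAt p) ∘ shift ∘ (2 +_)))))))) ⟩
    ℓ + (ℓ + (ΣA + (j + (j + ΣT))))          ∎
    where
    open ≡-Reasoning
    p' : ℕ → ℕ
    p' i = conjAt p (suc i)
    ℓ≡ : ℓ ≡ 2 + (d + (2 + e))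
    ℓ≡ = trans (sym j+2+e≡ℓ) (trans (cong (λ x → x + 2 + e) (sym 2+d≡j)) (rearrange d e))
      where
      rearrange : ∀ d e → 2 + d + 2 + e ≡ 2 + (d + (2 + e))
      rearrange = solve-∀
    shift : ∀ c → 3 + (d + c) ≡ j + suc c
    shift c = trans (rearrange d c) (cong (_+ suc c) 2+d≡j)
      where
      rearrange : ∀ d c → 3 + (d + c) ≡ 2 + d + suc c
      rearrange = solve-∀

  sum-φ : sum (φ p j) ≡ n
  sum-φ = begin
    sum (φ p j)
      ≡⟨ sum-++ (innerColumns p j) _ ⟩
    ΣA + (suc j + (suc j + (suc j + (suc j + sum (outerColumns p j)))))
      ≡⟨ cong (λ x → ΣA + (suc j + (suc j + (suc j + (suc j + x))))) sum-outer ⟩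
    ΣA + (suc j + (suc j + (suc j + (suc j + (e * 2 + ΣT)))))
      ≡⟨ rearrange ΣA j e ΣT ⟩
    (j + 2 + e) + ((j + 2 + e) + (ΣA + (j + (j + ΣT))))
      ≡⟨ cong (λ x → x + (x + (ΣA + (j + (j + ΣT))))) j+2+e≡ℓ ⟩
    ℓ + (ℓ + (ΣA + (j + (j + ΣT))))
      ≡⟨ sym n≡ ⟩
    n ∎
    where
    open ≡-Reasoning
    sum-outer : sum (outerColumns p j) ≡ e * 2 + ΣT
    sum-outer = trans (sum-applyUpTo-+ (λ _ → 2) _ e) (cong (_+ ΣT) (sum-applyUpTo-const e 2))
    rearrange : ∀ A j e T → A + (suc j + (suc j + (suc j + (suc j + (e * 2 + T)))))
                          ≡ (j + 2 + e) + ((j + 2 + e) + (A + (j + (j + T))))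
    rearrange = solve-∀

  nth-φ-j : nth (φ p j) j ≡ suc j
  nth-φ-j = trans (sym (nth-drop j (φ p j) 0)) (cong (λ xs → nth xs 0) (drop-φ 0))

  φ-tail≤ : ∀ i → j ≤ i → nth (φ p j) i ≤ suc j
  φ-tail≤ i j≤i =
    subst (_≤ suc j) nth≡ (nth-≤ (All.drop⁺ (i ∸ j) (≤-refl ∷ ≤-refl ∷ outer≤)) 0)
    where
    nth≡ : nth (drop (i ∸ j) (suc j ∷ suc j ∷ outerColumns p j)) 0 ≡ nth (φ p j) i
    nth≡ = trans (cong (λ xs → nth xs 0) (sym (drop-φ (i ∸ j))))
                 (trans (nth-drop (i ∸ j + j) (φ p j) 0) (cong (nth (φ p j)) (m∸n+n≡m j≤i)))

  φ-durfee : IsDurfeeSide (φ p j) (suc j)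
  φ-durfee = ≤-reflexive (sym nth-φ-j) , λ k _ k≤μₖ₋₁ → ≮⇒≥ λ sj<k →
    <⇒≱ sj<k (≤-trans k≤μₖ₋₁ (φ-tail≤ (k ∸ 1) (≤-trans (n≤1+n j) (∸-monoˡ-≤ 1 sj<k))))

  rank-φ : rank (φ p j) ≡ ℤ.+ 0
  rank-φ = trans (cong₂ (λ a b → ℤ.+ a ℤ.- ℤ.+ b) head-φ length-φ) (ℤP.+-inverseʳ (ℤ.+ ℓ))

  δ≡ : durfeeβ (φ p j) (suc j) ≡ suc j ∷ outerColumns p j
  δ≡ = drop-φ 1

  length-γ≡length-δ : len (durfeeα (φ p j) (suc j)) ≡ len (durfeeβ (φ p j) (suc j))
  length-γ≡length-δ = trans (length-durfeeα (φ p j) (suc j))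
    (trans (cong (_∸ suc j) (trans head-φ (sym length-φ))) (sym (length-drop (suc j) (φ p j))))

  γ₀≤d : nth (durfeeα (φ p j) (suc j)) 0 ≤ d
  γ₀≤d = subst (_≤ d) (sym γ₀≡)
    (≤-trans (conjAt≤length (innerColumns p j) _) (≤-reflexive length-inner))
    where
    γ₀≡ : nth (durfeeα (φ p j) (suc j)) 0 ≡ conjAt (innerColumns p j) (suc j + 1)
    γ₀≡ = begin
      nth (durfeeα (φ p j) (suc j)) 0  ≡⟨ nth-durfeeα φ-sorted (suc j) 0 ⟩
      conjAt (φ p j) (suc j + 1)       ≡⟨ conjAt-++ (innerColumns p j) _ _ ⟩
      conjAt (innerColumns p j) (suc j + 1)
        + conjAt (replicate 4 (suc j) ++ outerColumns p j) (suc j + 1)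
        ≡⟨ cong (conjAt (innerColumns p j) (suc j + 1) +_) (conjAt≡0 corner+outer<) ⟩
      conjAt (innerColumns p j) (suc j + 1) + 0
        ≡⟨ +-identityʳ _ ⟩
      conjAt (innerColumns p j) (suc j + 1) ∎
      where
      open ≡-Reasoning
      corner+outer< : All (_< suc j + 1) (replicate 4 (suc j) ++ outerColumns p j)
      corner+outer< = All.map (λ x≤sj → ≤-<-trans x≤sj (m<m+n (suc j) (s≤s z≤n))) corner+outer≤

  γ₀≤j'-3 : ℤ.+ nth (durfeeα (φ p j) (suc j)) 0 ℤ.≤ ℤ.+ suc j ℤ.- ℤ.+ 3
  γ₀≤j'-3 = subst (ℤ.+ nth (durfeeα (φ p j) (suc j)) 0 ℤ.≤_)
    (sym (trans (ℤP.m-n≡m⊖n (suc j) 3) (ℤP.⊖-≥ (≤-trans 3≤j (n≤1+n j))))) (+≤+ γ₀≤d)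

  φ∈P̄₁ : InPbar1 n (φ p j)
  φ∈P̄₁ =
    ((φ-sorted , φ-positive , sum-φ) , ℤP.≤-reflexive (sym rank-φ)) ,
    suc j , φ-durfee , s≤s z≤n , length-γ≡length-δ , γ₀≤j'-3 ,
    cong (λ xs → nth xs 0) δ≡ ,
    subst (All (2 ≤_)) (sym δ≡) (≤-trans (n≤1+n 2) (≤-trans 3≤j (n≤1+n j)) ∷ outer≥2)

  outer-recover : ∀ i → conjAt p (j + (3 + i)) ≡ nth (outerColumns p j) i ∸ 2
  outer-recover i with i <? e
  ... | yes i<e = sym (cong (_∸ 2) (nth-applyUpTo _ i<e))
  ... | no  i≮e = trans (conjAt≡0 (All.map (λ x≤ℓ → ≤-<-trans x≤ℓ ℓ<k) parts≤ℓ))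
                        (sym (cong (_∸ 2) (nth-applyUpTo-≥ _ (≮⇒≥ i≮e))))
    where
    ℓ<k : ℓ < j + (3 + i)
    ℓ<k = subst (_< j + (3 + i)) j+2+e≡ℓ
      (≤-<-trans (≤-trans (≤-reflexive (+-assoc j 2 e)) (+-monoʳ-≤ j (+-monoʳ-≤ 2 (≮⇒≥ i≮e))))
                 (+-monoʳ-< j ≤-refl))

  conjAt-recover : ∀ k → conjAt p k ≡ recoverConj (φ p j) j k
  conjAt-recover k with k ≤? 3 | k ≤? j | k ≤? j + 2
  ... | yes k≤3 | _       | _ = trans (conjAt≡length (All.map (≤-trans k≤3) parts≥3)) (sym length-φ)
  ... | no k≰3  | yes k≤j | _ = sym (begin
    nth (φ p j) (k ∸ 3)
      ≡⟨ nth-++ˡ (innerColumns p j) _ (subst (k ∸ 3 <_) (sym length-inner) k∸3<d) ⟩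
    nth (innerColumns p j) (k ∸ 3)  ≡⟨ nth-applyUpTo _ k∸3<d ⟩
    conjAt p (3 + (k ∸ 3))          ≡⟨ cong (conjAt p) (m+[n∸m]≡n 3≤k) ⟩
    conjAt p k                      ∎)
    where
    open ≡-Reasoning
    3≤k : 3 ≤ k
    3≤k = <⇒≤ (≰⇒> k≰3)
    k∸3<d : k ∸ 3 < d
    k∸3<d = +-cancelˡ-≤ 2 _ _
      (≤-trans (≤-reflexive (m+[n∸m]≡n 3≤k)) (≤-trans k≤j (≤-reflexive (sym 2+d≡j))))
  ... | no _ | no k≰j | yes k≤j+2 = ≤-antisym
    (≤-trans (conjAt-antimono p (subst (_≤ k) (+-comm 1 j) (≰⇒> k≰j))) (≤-reflexive p'ⱼ₊₁≡j))
    (≤-trans (≤-reflexive (sym p'ⱼ₊₂≡j)) (conjAt-antimono p k≤j+2))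
  ... | no _ | no _ | no k≰j+2 = begin
    conjAt p k                                    ≡⟨ cong (conjAt p) (sym k≡) ⟩
    conjAt p (j + (3 + (k ∸ (j + 3))))            ≡⟨ outer-recover (k ∸ (j + 3)) ⟩
    nth (outerColumns p j) (k ∸ (j + 3)) ∸ 2
      ≡⟨ cong (λ xs → nth xs (k ∸ (j + 3)) ∸ 2) (sym (drop-φ 2)) ⟩
    nth (drop (2 + j) (φ p j)) (k ∸ (j + 3)) ∸ 2  ∎
    where
    open ≡-Reasoning
    k≡ : j + (3 + (k ∸ (j + 3))) ≡ k
    k≡ = trans (sym (+-assoc j 3 _)) (m+[n∸m]≡n (subst (_≤ k) (sym (+-suc j 2)) (≰⇒> k≰j+2)))

φ-injective : ∀ {n n' p p' j j'} → Q̄₁Shape n p j → Q̄₁Shape n' p' j' → φ p j ≡ φ p' j' → p ≡ p'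
φ-injective {p = p} {p'} {j} {j'} S S' eq
  with suc-injective (durfeeSide-unique {φ p j} (φ-Properties.φ-durfee S)
         (subst (λ μ → IsDurfeeSide μ (suc j')) (sym eq) (φ-Properties.φ-durfee S')))
... | refl = conjAt-injective (sorted S) (sorted S') (positive S) (positive S') λ k _ → begin
  conjAt p k                ≡⟨ φ-Properties.conjAt-recover S k ⟩
  recoverConj (φ p j) j k   ≡⟨ cong (λ μ → recoverConj μ j k) eq ⟩
  recoverConj (φ p' j) j k  ≡⟨ sym (φ-Properties.conjAt-recover S' k) ⟩
  conjAt p' k               ∎
  where
  open ≡-Reasoning
  open Q̄₁Shape
  positive : ∀ {n p j} → Q̄₁Shape n p j → All (1 ≤_) p
  positive S = All.map (≤-trans (s≤s z≤n)) (parts≥3 S)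

lemma5p1 : (n : ℕ) →
    Σ (Σ (List ℕ) (InQbar1 n) → Σ (List ℕ) (InPbar1 n)) λ f →
      ∀ x y → proj₁ (f x) ≡ proj₁ (f y) → proj₁ x ≡ proj₁ y
lemma5p1 n = f , f-injective
  where
  f : Σ (List ℕ) (InQbar1 n) → Σ (List ℕ) (InPbar1 n)
  f (p , q) = φ p (proj₁ (proj₂ q)) , φ-Properties.φ∈P̄₁ (Q̄₁⇒shape q)

  f-injective : ∀ x y → proj₁ (f x) ≡ proj₁ (f y) → proj₁ x ≡ proj₁ y
  f-injective (p , q) (p' , q') = φ-injective (Q̄₁⇒shape q) (Q̄₁⇒shape q')
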